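{- Let $G$ be a disconnected skew graph with table $T$. Then the set of non-empty boxes of $T$ has one of the following four forms: ($\boxplus$) there are exactly four non-empty boxes, located at $(i_1,j_1),(i_1,j_2),(i_2,j_1),(i_2,j_2)$ with $i_1\ne i_2$ and $j_1\ne j_2$; ($\mathcal{R}$) all non-empty boxes lie in a single row; ($\mathcal{C}$) all non-empty boxes lie in a single column; ($\mathcal{R}\cup\mathcal{C}$) all non-empty boxes lie in the union of one row $R$ and one column $C$, with $V(R)\not\subseteq V(C)$ and $V(C)\not\subseteq V(R)$.
   Context: A skew graph is defined from a table $T$ of boxes with $m$ rows and $n$ columns, the box $(i,j)$ containing a non-negative integer $t_{ij}$: the graph has, for each box $(i,j)$, exactly $t_{ij}$ vertices located in that box, and two vertices are adjacent if and only if their boxes lie in different rows and in different columns (equivalently, skew graphs are exactly the complements of line graphs of bipartite multigraphs). A box is non-empty if it contains at least one vertex. For a row $R$ (column $C$) of $T$, $V(R)$ (resp. $V(C)$) is the set of vertices located in the boxes of $R$ (resp. $C$). -}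

module Defs where

open import Data.Nat using (ℕ; _<_)
open import Data.Fin using (Fin)
open import Data.Product using (Σ; _×_; _,_; ∃; ∃-syntax)
open import Data.Sum using (_⊎_)
open import Relation.Binary.PropositionalEquality using (_≡_; _≢_)
open import Relation.Binary.Construct.Closure.ReflexiveTransitive using (Star)
open import Relation.Nullary using (¬_)
open import Function.Bundles using (_⇔_)

-- A table with m rows and n columns; box (i , j) contains T i j vertices.
Table : ℕ → ℕ → Set
Table m n = Fin m → Fin n → ℕ

record Vertex {m n : ℕ} (T : Table m n) : Set where
  constructor vtx
  field
    row : Fin m
    col : Fin n
    idx : Fin (T row col)
open Vertex public

Adj : ∀ {m n} (T : Table m n) → Vertex T → Vertex T → Set
Adj T u v = (row u ≢ row v) × (col u ≢ col v)

Reachable : ∀ {m n} (T : Table m n) → Vertex T → Vertex T → Set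
Reachable T = Star (Adj T)

Disconnected : ∀ {m n} (T : Table m n) → Set
Disconnected T = ∃[ u ] ∃[ v ] ¬ Reachable T u v

NonEmpty : ∀ {m n} (T : Table m n) → Fin m → Fin n → Set
NonEmpty T i j = 0 < T i j

-- V(R_i) ⊆ V(C_j): every vertex located in row i is located in column j.
RowInCol : ∀ {m n} (T : Table m n) → Fin m → Fin n → Set
RowInCol T i j = ∀ (v : Vertex T) → row v ≡ i → col v ≡ j

ColInRow : ∀ {m n} (T : Table m n) → Fin m → Fin n → Set
ColInRow T i j = ∀ (v : Vertex T) → col v ≡ j → row v ≡ i

FormSquare : ∀ {m n} (T : Table m n) → Set
FormSquare {m} {n} T =
  Σ (Fin m) λ i₁ → Σ (Fin m) λ i₂ → Σ (Fin n) λ j₁ → Σ (Fin n) λ j₂ →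
    (i₁ ≢ i₂) × (j₁ ≢ j₂) ×
    (∀ i j → NonEmpty T i j ⇔ ((i ≡ i₁ ⊎ i ≡ i₂) × (j ≡ j₁ ⊎ j ≡ j₂)))

FormRow : ∀ {m n} (T : Table m n) → Set
FormRow {m} T = Σ (Fin m) λ r → ∀ i j → NonEmpty T i j → i ≡ r

FormCol : ∀ {m n} (T : Table m n) → Set
FormCol {m} {n} T = Σ (Fin n) λ c → ∀ i j → NonEmpty T i j → j ≡ c

FormRowCol : ∀ {m n} (T : Table m n) → Set
FormRowCol {m} {n} T = Σ (Fin m) λ r → Σ (Fin n) λ c →
  (∀ i j → NonEmpty T i j → i ≡ r ⊎ j ≡ c) ×
  ¬ RowInCol T r c × ¬ ColInRow T r c

{-# OPTIONS --safe #-}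
module Submission where

-- Two vertices in different rows and columns are adjacent, so two mutually unreachable
-- vertices u, v share a row (up to transposing the table), say u in box (a , b) and
-- v in box (a , d). Every non-empty box off row a lies in column b or d, since otherwise
-- its vertices are common neighbours of u and v. If column b or column d has no
-- non-empty box off row a, the non-empty boxes lie in one row plus one column, and the
-- three forms R, C, R ∪ C are told apart by which of these two lines has boxes off the
-- other. If both columns have such boxes, the paths u, (i' , d), (i , b), v and
-- u, (i , d), (a , j), (i , b), v show that they sit in a single row i and that row a
-- has no non-empty box outside columns b and d: this is the square.

open import Defs
open import Data.Nat using (ℕ; >-nonZero⁻¹)
open import Data.Nat.Properties using (_<?_)
open import Data.Fin using (Fin; fromℕ<; _≟_)
open import Data.Fin.Properties using (any?; nonZeroIndex)
open import Data.Sum using (_⊎_; inj₁; inj₂)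
import Data.Sum as Sum
open import Data.Product using (_×_; _,_; ∃)
import Data.Product as Product
open import Data.Empty using (⊥-elim)
open import Relation.Nullary using (¬_; Dec; yes; no)
open import Relation.Nullary.Decidable using (_×-dec_; ¬?)
open import Relation.Binary.PropositionalEquality using (_≡_; _≢_; refl; sym; trans; ≢-sym)
open import Relation.Binary.Construct.Closure.ReflexiveTransitive using (ε; _◅_; gmap)
open import Function.Base using (_∘′_)
open import Function.Bundles using (mk⇔; Equivalence)

Form : ∀ {m n} → Table m n → Set
Form T = FormSquare T ⊎ FormRow T ⊎ FormCol T ⊎ FormRowCol T

module _ {m n : ℕ} (T : Table m n) where

  vertexIn : ∀ {i j} → NonEmpty T i j → Vertex T
  vertexIn {i} {j} p = vtx i j (fromℕ< p)

  nonEmpty-box : (v : Vertex T) → NonEmpty T (row v) (col v)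
  nonEmpty-box v = >-nonZero⁻¹ _ {{nonZeroIndex (idx v)}}

  nonEmpty? : ∀ i j → Dec (NonEmpty T i j)
  nonEmpty? i j = 0 <? T i j

  via : ∀ {u v} w → Adj T u w → Reachable T w v → Reachable T u v
  via w = _◅_

  InRowOrCol : Fin m → Fin n → Set
  InRowOrCol r c = ∀ i j → NonEmpty T i j → i ≡ r ⊎ j ≡ c

  OffRowIn : Fin m → Fin n → Set
  OffRowIn r c = ∃ λ i → NonEmpty T i c × i ≢ r

  OffColIn : Fin m → Fin n → Set
  OffColIn r c = ∃ λ j → NonEmpty T r j × j ≢ c

  offRowIn? : ∀ r c → Dec (OffRowIn r c)
  offRowIn? r c = any? λ i → nonEmpty? i c ×-dec ¬? (i ≟ r)

  offColIn? : ∀ r c → Dec (OffColIn r c)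
  offColIn? r c = any? λ j → nonEmpty? r j ×-dec ¬? (j ≟ c)

  inRow-if-¬offRowIn : ∀ {r c} → InRowOrCol r c → ¬ OffRowIn r c →
                       ∀ i j → NonEmpty T i j → i ≡ r
  inRow-if-¬offRowIn {r = r} cover none i j p with cover i j p | i ≟ r
  ... | inj₁ i≡r  | _       = i≡r
  ... | inj₂ _    | yes i≡r = i≡r
  ... | inj₂ refl | no i≢r  = ⊥-elim (none (i , p , i≢r))

  inCol-if-¬offColIn : ∀ {r c} → InRowOrCol r c → ¬ OffColIn r c →
                       ∀ i j → NonEmpty T i j → j ≡ c
  inCol-if-¬offColIn {c = c} cover none i j p with cover i j p | j ≟ c
  ... | inj₂ j≡c  | _       = j≡c
  ... | inj₁ _    | yes j≡c = j≡c
  ... | inj₁ refl | no j≢c  = ⊥-elim (none (j , p , j≢c))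

  rowCol-form : ∀ r c → InRowOrCol r c → FormRow T ⊎ FormCol T ⊎ FormRowCol T
  rowCol-form r c cover with offRowIn? r c | offColIn? r c
  ... | no none | _ = inj₁ (r , inRow-if-¬offRowIn cover none)
  ... | yes _ | no none = inj₂ (inj₁ (c , inCol-if-¬offColIn cover none))
  ... | yes (i , pᵢ , i≢r) | yes (j , pⱼ , j≢c) =
    inj₂ (inj₂ (r , c , cover ,
      (λ rowInCol → j≢c (rowInCol (vertexIn pⱼ) refl)) ,
      (λ colInRow → i≢r (colInRow (vertexIn pᵢ) refl))))

  module UnreachableInRow {a b d} (kᵤ : Fin (T a b)) (kᵥ : Fin (T a d))
                          (unreachable : ¬ Reachable T (vtx a b kᵤ) (vtx a d kᵥ)) where

    u v : Vertex T
    u = vtx a b kᵤ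
    v = vtx a d kᵥ

    inRowOrTwoCols : ∀ i j → NonEmpty T i j → i ≡ a ⊎ j ≡ b ⊎ j ≡ d
    inRowOrTwoCols i j p with i ≟ a | j ≟ b | j ≟ d
    ... | yes i≡a | _       | _       = inj₁ i≡a
    ... | no _    | yes j≡b | _       = inj₂ (inj₁ j≡b)
    ... | no _    | no _    | yes j≡d = inj₂ (inj₂ j≡d)
    ... | no i≢a  | no j≢b  | no j≢d  =
      ⊥-elim (unreachable (via (vertexIn p) (≢-sym i≢a , ≢-sym j≢b) ((i≢a , j≢d) ◅ ε)))

    dropSecondCol : ¬ OffRowIn a d → InRowOrCol a b
    dropSecondCol none i j p with inRowOrTwoCols i j p | i ≟ a
    ... | inj₁ i≡a          | _       = inj₁ i≡a
    ... | inj₂ (inj₁ j≡b)   | _       = inj₂ j≡b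
    ... | inj₂ (inj₂ _)     | yes i≡a = inj₁ i≡a
    ... | inj₂ (inj₂ refl)  | no i≢a  = ⊥-elim (none (i , p , i≢a))

    dropFirstCol : ¬ OffRowIn a b → InRowOrCol a d
    dropFirstCol none i j p with inRowOrTwoCols i j p | i ≟ a
    ... | inj₁ i≡a          | _       = inj₁ i≡a
    ... | inj₂ (inj₂ j≡d)   | _       = inj₂ j≡d
    ... | inj₂ (inj₁ _)     | yes i≡a = inj₁ i≡a
    ... | inj₂ (inj₁ refl)  | no i≢a  = ⊥-elim (none (i , p , i≢a))

    module TwoCols (b≢d : b ≢ d) where

      offRow-rows-equal : ∀ {i i'} → NonEmpty T i b → i ≢ a → NonEmpty T i' d → i' ≢ a → i ≡ i'
      offRow-rows-equal {i} {i'} pᵢ i≢a pᵢ' i'≢a with i ≟ i'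
      ... | yes i≡i' = i≡i'
      ... | no i≢i' =
        ⊥-elim (unreachable (via (vertexIn pᵢ') (≢-sym i'≢a , b≢d)
                              (via (vertexIn pᵢ) (≢-sym i≢i' , ≢-sym b≢d) ((i≢a , b≢d) ◅ ε))))

      row-in-twoCols : ∀ {i i' j} → NonEmpty T i b → i ≢ a → NonEmpty T i' d → i' ≢ a →
                       NonEmpty T a j → j ≡ b ⊎ j ≡ d
      row-in-twoCols {j = j} pᵢ i≢a pᵢ' i'≢a pⱼ with j ≟ b | j ≟ d
      ... | yes j≡b | _       = inj₁ j≡b
      ... | no _    | yes j≡d = inj₂ j≡d
      ... | no j≢b  | no j≢d  =
        ⊥-elim (unreachable (via (vertexIn pᵢ') (≢-sym i'≢a , b≢d)
                              (via (vertexIn pⱼ) (i'≢a , ≢-sym j≢d)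
                                (via (vertexIn pᵢ) (≢-sym i≢a , j≢b) ((i≢a , b≢d) ◅ ε)))))

      square : OffRowIn a b → OffRowIn a d → FormSquare T
      square (i , pᵢ , i≢a) (i' , pᵢ' , i'≢a) =
        a , i , b , d , ≢-sym i≢a , b≢d , λ k j → mk⇔ (to k j) (from k j)
        where
        i≡i' : i ≡ i'
        i≡i' = offRow-rows-equal pᵢ i≢a pᵢ' i'≢a

        to : ∀ k j → NonEmpty T k j → (k ≡ a ⊎ k ≡ i) × (j ≡ b ⊎ j ≡ d)
        to k j p with k ≟ a
        ... | yes refl = inj₁ refl , row-in-twoCols pᵢ i≢a pᵢ' i'≢a p
        ... | no k≢a with inRowOrTwoCols k j p
        ...   | inj₁ k≡a         = ⊥-elim (k≢a k≡a)
        ...   | inj₂ (inj₁ refl) = inj₂ (trans (offRow-rows-equal p k≢a pᵢ' i'≢a) (sym i≡i')) , inj₁ refl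
        ...   | inj₂ (inj₂ refl) = inj₂ (sym (offRow-rows-equal pᵢ i≢a p k≢a)) , inj₂ refl

        from : ∀ k j → (k ≡ a ⊎ k ≡ i) × (j ≡ b ⊎ j ≡ d) → NonEmpty T k j
        from _ _ (inj₁ refl , inj₁ refl) = nonEmpty-box u
        from _ _ (inj₁ refl , inj₂ refl) = nonEmpty-box v
        from _ _ (inj₂ refl , inj₁ refl) = pᵢ
        from _ _ (inj₂ refl , inj₂ refl) rewrite i≡i' = pᵢ'

    form : Form T
    form with b ≟ d
    ... | yes refl = inj₂ (rowCol-form a b λ i j p → Sum.map₂ Sum.reduce (inRowOrTwoCols i j p))
    ... | no b≢d with offRowIn? a b | offRowIn? a d
    ...   | no none | _       = inj₂ (rowCol-form a d (dropFirstCol none))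
    ...   | yes _   | no none = inj₂ (rowCol-form a b (dropSecondCol none))
    ...   | yes offᵇ | yes offᵈ = inj₁ (TwoCols.square b≢d offᵇ offᵈ)

transpose : ∀ {m n} → Table m n → Table n m
transpose T j i = T i j

module _ {m n : ℕ} (T : Table m n) where

  transpose-vertex : Vertex T → Vertex (transpose T)
  transpose-vertex w = vtx (col w) (row w) (idx w)

  untranspose-vertex : Vertex (transpose T) → Vertex T
  untranspose-vertex w = vtx (col w) (row w) (idx w)

  untranspose-reachable : ∀ {u v} → Reachable (transpose T) u v →
                          Reachable T (untranspose-vertex u) (untranspose-vertex v)
  untranspose-reachable = gmap untranspose-vertex Product.swap

  untranspose-form : Form (transpose T) → Form T
  untranspose-form (inj₁ (i₁ , i₂ , j₁ , j₂ , i₁≢i₂ , j₁≢j₂ , boxes)) =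
    inj₁ (j₁ , j₂ , i₁ , i₂ , j₁≢j₂ , i₁≢i₂ , λ i j →
      mk⇔ (Product.swap ∘′ Equivalence.to (boxes j i)) (Equivalence.from (boxes j i) ∘′ Product.swap))
  untranspose-form (inj₂ (inj₁ (r , inRow))) = inj₂ (inj₂ (inj₁ (r , λ i j → inRow j i)))
  untranspose-form (inj₂ (inj₂ (inj₁ (c , inCol)))) = inj₂ (inj₁ (c , λ i j → inCol j i))
  untranspose-form (inj₂ (inj₂ (inj₂ (r , c , cover , ¬rowInCol , ¬colInRow)))) =
    inj₂ (inj₂ (inj₂ (c , r , (λ i j p → Sum.swap (cover j i p)) ,
      (λ rowInCol → ¬colInRow λ w → rowInCol (untranspose-vertex w)) ,
      (λ colInRow → ¬rowInCol λ w → colInRow (untranspose-vertex w)))))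

sameRow-form : ∀ {m n} (T : Table m n) (u v : Vertex T) → ¬ Reachable T u v → row u ≡ row v → Form T
sameRow-form T (vtx a b kᵤ) (vtx .a d kᵥ) unreachable refl = UnreachableInRow.form T kᵤ kᵥ unreachable

theorem7 : ∀ {m n : ℕ} (T : Table m n) → Disconnected T →
    FormSquare T ⊎ FormRow T ⊎ FormCol T ⊎ FormRowCol T
theorem7 T (u , v , unreachable) with row u ≟ row v | col u ≟ col v
... | yes sameRow | _ = sameRow-form T u v unreachable sameRow
... | no _ | yes sameCol =
  untranspose-form T (sameRow-form (transpose T) (transpose-vertex T u) (transpose-vertex T v)
                                   (unreachable ∘′ untranspose-reachable T) sameCol)
... | no r≢ | no c≢ = ⊥-elim (unreachable ((r≢ , c≢) ◅ ε))
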